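{- Let $p$ be a prime, $n,m\in\mathbb{N}$, $0\le j<i\le n$ and $d\in U_1$. Let $\chi_j:R_mG\to R_mG_j$ be the natural $R_m$-homomorphism. Then $\chi_j(Q_d(i,0))\in p^{i-j}R_mG_j$. Moreover: (1) if $p>2$, or $d\in U_2$, or $j>0$, then $\chi_j(Q_d(i,0))\equiv p^{i-j}Q_d(j,0)\pmod{p^{i-j+1}R_mG_j}$; (2) if $p=2$, $d=-1$ and $j=0$, then $\chi_j(Q_d(i,0))=0$; (3) if $p=2$, $d\in -U_v\setminus -U_{v+1}$ for some $v\ge2$, and $j=0$, then $\chi_j(Q_d(i,0))\equiv 2^{i+v-1}\pmod{2^{i+v}R_mG_j}$.
   Context: $G$ is cyclic of order $p^n$ with generator $\sigma$; $G_j$ its quotient of order $p^j$. $R_m=\mathbb{Z}/p^m\mathbb{Z}$. $U_i=1+p^i\mathbb{Z}$, $-U_v=\{ -u:u\in U_v\}$. $Q_d(i,j)=\sum_{k=0}^{p^{i-j}-1}(d^{p^j})^{p^{i-j}-1-k}(\sigma^{p^j})^k$ (with $d$ acting through its image in $R_m$). -}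

module Defs where

open import Data.Nat as ℕ using (ℕ; zero; suc; _<ᵇ_; _≡ᵇ_; NonZero)
open import Data.Nat.DivMod using (_%_)
open import Data.Integer as ℤ using (ℤ; +_; 0ℤ; -_; _-_; _^_)
open import Data.Integer.Divisibility using (_∣_)
open import Data.Bool using (if_then_else_)
open import Data.Product using (∃)

-- Elements of the group ring R_m G_N, where G_N is cyclic of order N with
-- generator τ, are represented by integer coefficient functions
-- a : ℕ → ℤ, a k being the coefficient of τ^k (only k < N is relevant;
-- coefficients are read modulo p^m).
GR : Set
GR = ℕ → ℤ

_mod′_ : ℕ → ℕ → ℕ
k mod′ zero    = k
k mod′ (suc M) = k % suc M

sumTo : ℕ → (ℕ → ℤ) → ℤ
sumTo zero    f = 0ℤ
sumTo (suc N) f = sumTo N f ℤ.+ f N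

-- The natural map χ : R_m G_N → R_m G_M (M ∣ N), σ^k ↦ τ^(k mod M):
-- coefficient of τ^r in χ(a) is Σ_{k<N, k ≡ r mod M} a k.
χ : (N M : ℕ) → GR → GR
χ N M a r = sumTo N (λ k → if (k mod′ M) ≡ᵇ r then a k else 0ℤ)

Q0 : (p : ℕ) → ℤ → (i : ℕ) → GR
Q0 p d i k = if k <ᵇ (p ℕ.^ i) then d ^ ((p ℕ.^ i) ℕ.∸ 1 ℕ.∸ k) else 0ℤ

_·_ : ℤ → GR → GR
(s · a) k = s ℤ.* a k

_⊖_ : GR → GR → GR
(a ⊖ b) k = a k - b k

scalar : ℤ → GR
scalar c zero    = c
scalar c (suc k) = 0ℤ

-- a ∈ s·(R_m G_N), where R_m = ℤ / pm ℤ: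
-- ∃ y ∈ R_m G_N with a = s·y in R_m G_N.
InMul : (pm : ℕ) (N : ℕ) (s : ℤ) → GR → Set
InMul pm N s a = ∃ λ (y : GR) → ∀ r → r ℕ.< N → (+ pm) ∣ (a r - s ℤ.* y r)

CongMod : (pm : ℕ) (N : ℕ) (s : ℤ) → GR → GR → Set
CongMod pm N s a b = InMul pm N s (a ⊖ b)

IsZero : (pm : ℕ) (N : ℕ) → GR → Set
IsZero pm N a = ∀ r → r ℕ.< N → (+ pm) ∣ a r

_∈U[_,_] : ℤ → ℕ → ℕ → Set
d ∈U[ p , i ] = (+ (p ℕ.^ i)) ∣ (d - + 1)

module Submission where

-- Evaluated at τ^r (r < p^j), χ_j(Q_d(i,0)) collects the terms d^(p^i-1-k) with k ≡ r (mod p^j);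
-- factoring out d^(p^j-1-r) leaves the geometric sum S(e, p^(i-j)) = Σ_{t<p^(i-j)} e^t with
-- e = d^(p^j) ≡ 1 (mod p).  So every part of the lemma is a statement about S(e, p^k).
-- Since S(e, N·M) = S(e^M, N)·S(e, M) and S(e, N) ≡ N (mod e-1), induction on k gives p^k ∣ S(e, p^k).
-- The sharper S(e, p^k) ≡ p^k (mod p^(k+1)) follows by the same induction once S(e, p) ≡ p (mod p²),
-- which holds for p odd (S(e, p) - p = (e-1)·Σ_{t<p} S(e, t) and Σ_{t<p} S(e, t) ≡ Σ_{t<p} t = p(p-1)/2
-- ≡ 0 (mod p)) and for p = 2 when e ≡ 1 (mod 4).  For p = 2, j = 0 one splits
-- S(d, 2^i) = S(d², 2^(i-1))·(1+d) and reads off the 2-adic valuation of 1 + d.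

open import Defs
open import Data.Bool.Base using (true; false; T; if_then_else_)
open import Data.Bool.Properties using (if-eta)
open import Data.Empty using (⊥-elim)
open import Data.Integer.Base using (ℤ; +_; -_; 0ℤ; 1ℤ)
import Data.Integer.Properties as ℤP
import Data.Integer.Divisibility as Unsigned
open import Data.Integer.Divisibility.Signed
  using (_∣_; divides; ∣ᵤ⇒∣; ∣⇒∣ᵤ; ∣-refl; ∣-trans; ∣m∣n⇒∣m+n; ∣m⇒∣m*n; *-monoʳ-∣; *-monoˡ-∣)
import Data.Integer.DivMod as ℤD
open import Data.Integer.Tactic.RingSolver using (solve-∀)
open import Data.Nat.Base as ℕ using (ℕ; zero; suc; _<_; _≤_; z≤n; s≤s; _<ᵇ_; _≡ᵇ_; NonZero)
import Data.Nat.Properties as ℕP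
import Data.Nat.Divisibility as ℕD
open import Data.Nat.DivMod using (_%_; _/_; m≡m%n+[m/n]*n; m%n<n; [m+kn]%n≡m%n; m<n⇒m%n≡m)
import Data.Nat.Tactic.RingSolver as ℕSolver
open import Data.Nat.Primality using (Prime; prime⇒nonTrivial; prime⇒nonZero; prime⇒irreducible)
open import Data.Product using (_×_; _,_; ∃)
open import Data.Sum using (_⊎_; inj₁; inj₂)
open import Relation.Binary.PropositionalEquality
open import Relation.Nullary using (¬_)

module _ where
  open import Data.Integer.Base using (_+_; _*_; _-_; _^_)
  open ≡-Reasoning

  if-true : ∀ {A : Set} {b} {x y : A} → T b → (if b then x else y) ≡ x
  if-true {b = true} _ = refl

  if-false : ∀ {A : Set} {b} {x y : A} → ¬ T b → (if b then x else y) ≡ y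
  if-false {b = true}  ¬b = ⊥-elim (¬b _)
  if-false {b = false} _  = refl

  x-y≡z⇒x≡z+y : ∀ x y {z : ℤ} → x - y ≡ z → x ≡ z + y
  x-y≡z⇒x≡z+y x y refl = sym (cancel x y)
    where
    cancel : ∀ x y → (x - y) + y ≡ x
    cancel = solve-∀

  ∣0 : ∀ q → q ∣ 0ℤ
  ∣0 q = divides 0ℤ (sym (ℤP.*-zeroˡ q))

  ∣m-n∣n⇒∣m : ∀ {q m n} → q ∣ m - n → q ∣ n → q ∣ m
  ∣m-n∣n⇒∣m {q} {m} {n} q∣m-n q∣n = subst (q ∣_) (cancel m n) (∣m∣n⇒∣m+n q∣m-n q∣n)
    where
    cancel : ∀ m n → (m - n) + n ≡ m
    cancel = solve-∀

  *-pres-∣ : ∀ {a b c d} → a ∣ b → c ∣ d → a * c ∣ b * d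
  *-pres-∣ {a} {b} {c} {d} a∣b c∣d = ∣-trans (*-monoʳ-∣ a c∣d) (*-monoˡ-∣ d a∣b)

  sumTo-cong : ∀ N {f g : ℕ → ℤ} → (∀ k → k < N → f k ≡ g k) → sumTo N f ≡ sumTo N g
  sumTo-cong zero    _   = refl
  sumTo-cong (suc N) f≗g = cong₂ _+_ (sumTo-cong N (λ k k<N → f≗g k (ℕP.m<n⇒m<1+n k<N))) (f≗g N ℕP.≤-refl)

  sumTo-zero : ∀ N {f : ℕ → ℤ} → (∀ k → k < N → f k ≡ 0ℤ) → sumTo N f ≡ 0ℤ
  sumTo-zero zero    _   = refl
  sumTo-zero (suc N) f≗0 = cong₂ _+_ (sumTo-zero N (λ k k<N → f≗0 k (ℕP.m<n⇒m<1+n k<N))) (f≗0 N ℕP.≤-refl)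

  sumTo-+ : ∀ M N (f : ℕ → ℤ) → sumTo (M ℕ.+ N) f ≡ sumTo M f + sumTo N (λ s → f (M ℕ.+ s))
  sumTo-+ M zero    f rewrite ℕP.+-identityʳ M = sym (ℤP.+-identityʳ _)
  sumTo-+ M (suc N) f rewrite ℕP.+-suc M N =
    trans (cong (_+ f (M ℕ.+ N)) (sumTo-+ M N f)) (ℤP.+-assoc (sumTo M f) _ _)

  sumTo-prefix : ∀ K L {f : ℕ → ℤ} → K ≤ L → (∀ k → K ≤ k → f k ≡ 0ℤ) → sumTo L f ≡ sumTo K f
  sumTo-prefix K L {f} K≤L f≗0 = begin
    sumTo L f                                          ≡⟨ cong (λ n → sumTo n f) (ℕP.m+[n∸m]≡n K≤L) ⟨
    sumTo (K ℕ.+ (L ℕ.∸ K)) f                          ≡⟨ sumTo-+ K (L ℕ.∸ K) f ⟩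
    sumTo K f + sumTo (L ℕ.∸ K) (λ s → f (K ℕ.+ s))  ≡⟨ cong (λ x → sumTo K f + x) (sumTo-zero (L ℕ.∸ K) (λ s _ → f≗0 (K ℕ.+ s) (ℕP.m≤m+n K s))) ⟩
    sumTo K f + 0ℤ                                     ≡⟨ ℤP.+-identityʳ _ ⟩
    sumTo K f                                          ∎

  sumTo-*ʳ : ∀ N (f : ℕ → ℤ) c → sumTo N (λ t → f t * c) ≡ sumTo N f * c
  sumTo-*ʳ zero    f c = sym (ℤP.*-zeroˡ c)
  sumTo-*ʳ (suc N) f c =
    trans (cong (_+ f N * c) (sumTo-*ʳ N f c)) (sym (ℤP.*-distribʳ-+ c (sumTo N f) (f N)))

  sumTo-*ˡ : ∀ N (f : ℕ → ℤ) c → sumTo N (λ t → c * f t) ≡ c * sumTo N f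
  sumTo-*ˡ N f c = begin
    sumTo N (λ t → c * f t)  ≡⟨ sumTo-cong N (λ t _ → ℤP.*-comm c (f t)) ⟩
    sumTo N (λ t → f t * c)  ≡⟨ sumTo-*ʳ N f c ⟩
    sumTo N f * c            ≡⟨ ℤP.*-comm _ c ⟩
    c * sumTo N f            ∎

  sumTo-blocks : ∀ N M (f : ℕ → ℤ) →
    sumTo (N ℕ.* M) f ≡ sumTo N (λ t → sumTo M (λ s → f (t ℕ.* M ℕ.+ s)))
  sumTo-blocks zero    M f = refl
  sumTo-blocks (suc N) M f = begin
    sumTo (M ℕ.+ N ℕ.* M) f
      ≡⟨ cong (λ n → sumTo n f) (ℕP.+-comm M (N ℕ.* M)) ⟩
    sumTo (N ℕ.* M ℕ.+ M) f
      ≡⟨ sumTo-+ (N ℕ.* M) M f ⟩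
    sumTo (N ℕ.* M) f + sumTo M (λ s → f (N ℕ.* M ℕ.+ s))
      ≡⟨ cong (_+ sumTo M (λ s → f (N ℕ.* M ℕ.+ s))) (sumTo-blocks N M f) ⟩
    sumTo N (λ t → sumTo M (λ s → f (t ℕ.* M ℕ.+ s))) + sumTo M (λ s → f (N ℕ.* M ℕ.+ s))
      ∎

  sumTo-suc : ∀ N (f : ℕ → ℤ) → sumTo (suc N) f ≡ f 0 + sumTo N (λ t → f (suc t))
  sumTo-suc zero    f = trans (ℤP.+-identityˡ (f 0)) (sym (ℤP.+-identityʳ (f 0)))
  sumTo-suc (suc N) f = trans (cong (_+ f (suc N)) (sumTo-suc N f)) (ℤP.+-assoc (f 0) _ _)

  sumTo-reverse : ∀ N (f : ℕ → ℤ) → sumTo N (λ t → f (N ℕ.∸ 1 ℕ.∸ t)) ≡ sumTo N f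
  sumTo-reverse zero    f = refl
  sumTo-reverse (suc N) f = begin
    sumTo N (λ t → f (N ℕ.∸ t)) + f (N ℕ.∸ N)
      ≡⟨ cong₂ _+_ (sumTo-cong N (λ t t<N → cong f (∸-pred t<N))) (cong f (ℕP.n∸n≡0 N)) ⟩
    sumTo N (λ t → f (suc (N ℕ.∸ 1 ℕ.∸ t))) + f 0
      ≡⟨ cong (_+ f 0) (sumTo-reverse N (λ t → f (suc t))) ⟩
    sumTo N (λ t → f (suc t)) + f 0
      ≡⟨ ℤP.+-comm _ (f 0) ⟩
    f 0 + sumTo N (λ t → f (suc t))
      ≡⟨ sumTo-suc N f ⟨
    sumTo (suc N) f
      ∎
    where
    ∸-pred : ∀ {N t} → t < N → N ℕ.∸ t ≡ suc (N ℕ.∸ 1 ℕ.∸ t)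
    ∸-pred {suc N} (s≤s t≤N) = ℕP.+-∸-assoc 1 t≤N

  sumTo-indicator : ∀ N r (f : ℕ → ℤ) → r < N → sumTo N (λ s → if s ≡ᵇ r then f s else 0ℤ) ≡ f r
  sumTo-indicator (suc N) r f r<1+N with ℕP.m<1+n⇒m<n∨m≡n r<1+N
  ... | inj₁ r<N = begin
    sumTo N _ + (if N ≡ᵇ r then f N else 0ℤ)  ≡⟨ cong₂ _+_ (sumTo-indicator N r f r<N) (if-false (λ N≡r → ℕP.<-irrefl (sym (ℕP.≡ᵇ⇒≡ N r N≡r)) r<N)) ⟩
    f r + 0ℤ                                   ≡⟨ ℤP.+-identityʳ (f r) ⟩
    f r                                        ∎
  ... | inj₂ refl = begin
    sumTo N _ + (if N ≡ᵇ N then f N else 0ℤ)  ≡⟨ cong₂ _+_ (sumTo-zero N (λ s s<N → if-false (λ s≡N → ℕP.<-irrefl (ℕP.≡ᵇ⇒≡ s N s≡N) s<N))) (if-true (ℕP.≡⇒≡ᵇ N N refl)) ⟩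
    0ℤ + f N                                   ≡⟨ ℤP.+-identityˡ (f N) ⟩
    f N                                        ∎

  sumTo-residueClass : ∀ N M .{{_ : NonZero M}} r (f : ℕ → ℤ) → r < M →
    sumTo (N ℕ.* M) (λ k → if k % M ≡ᵇ r then f k else 0ℤ) ≡ sumTo N (λ t → f (t ℕ.* M ℕ.+ r))
  sumTo-residueClass N M r f r<M = trans (sumTo-blocks N M _) (sumTo-cong N (λ t _ → begin
    sumTo M (λ s → if (t ℕ.* M ℕ.+ s) % M ≡ᵇ r then f (t ℕ.* M ℕ.+ s) else 0ℤ)
      ≡⟨ sumTo-cong M (λ s s<M → cong (λ x → if x ≡ᵇ r then f (t ℕ.* M ℕ.+ s) else 0ℤ) (residue t s<M)) ⟩
    sumTo M (λ s → if s ≡ᵇ r then f (t ℕ.* M ℕ.+ s) else 0ℤ)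
      ≡⟨ sumTo-indicator M r (λ s → f (t ℕ.* M ℕ.+ s)) r<M ⟩
    f (t ℕ.* M ℕ.+ r)
      ∎))
    where
    residue : ∀ t {s} → s < M → (t ℕ.* M ℕ.+ s) % M ≡ s
    residue t {s} s<M =
      trans (cong (_% M) (ℕP.+-comm (t ℕ.* M) s)) (trans ([m+kn]%n≡m%n s t M) (m<n⇒m%n≡m s<M))

  blockIndex< : ∀ {N M t r} → t < N → r < M → t ℕ.* M ℕ.+ r < N ℕ.* M
  blockIndex< {N} {M} {t} t<N r<M = ℕP.<-≤-trans (ℕP.+-monoʳ-< (t ℕ.* M) r<M)
    (subst (ℕ._≤ N ℕ.* M) (ℕP.+-comm M (t ℕ.* M)) (ℕP.*-monoˡ-≤ M t<N))

  blockExponent : ∀ {N M t r} → t < N → r < M →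
    N ℕ.* M ℕ.∸ 1 ℕ.∸ (t ℕ.* M ℕ.+ r) ≡ (M ℕ.∸ 1 ℕ.∸ r) ℕ.+ (N ℕ.∸ 1 ℕ.∸ t) ℕ.* M
  blockExponent {t = t} {r} t<N r<M with ℕP.m≤n⇒∃[o]m+o≡n t<N | ℕP.m≤n⇒∃[o]m+o≡n r<M
  ... | a , refl | b , refl = begin
    r ℕ.+ b ℕ.+ (t ℕ.+ a) ℕ.* M ℕ.∸ (t ℕ.* M ℕ.+ r)           ≡⟨ cong (ℕ._∸ (t ℕ.* M ℕ.+ r)) (regroup t a r b) ⟩
    (t ℕ.* M ℕ.+ r) ℕ.+ (b ℕ.+ a ℕ.* M) ℕ.∸ (t ℕ.* M ℕ.+ r)  ≡⟨ ℕP.m+n∸m≡n (t ℕ.* M ℕ.+ r) (b ℕ.+ a ℕ.* M) ⟩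
    b ℕ.+ a ℕ.* M                                            ≡⟨ cong₂ (λ x y → x ℕ.+ y ℕ.* M) (ℕP.m+n∸m≡n r b) (ℕP.m+n∸m≡n t a) ⟨
    (r ℕ.+ b ℕ.∸ r) ℕ.+ (t ℕ.+ a ℕ.∸ t) ℕ.* M               ∎
    where
    M = suc r ℕ.+ b
    regroup : ∀ t a r b → r ℕ.+ b ℕ.+ (t ℕ.+ a) ℕ.* suc (r ℕ.+ b)
                        ≡ (t ℕ.* suc (r ℕ.+ b) ℕ.+ r) ℕ.+ (b ℕ.+ a ℕ.* suc (r ℕ.+ b))
    regroup = ℕSolver.solve-∀

  geomSum : ℤ → ℕ → ℤ
  geomSum e N = sumTo N (e ^_)

  -- Σ_{k<L} d^(L-1-k) σ^k, so that Q0 p d i is definitionally geomElt d (p ^ i).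
  geomElt : ℤ → ℕ → GR
  geomElt d L k = if k <ᵇ L then d ^ (L ℕ.∸ 1 ℕ.∸ k) else 0ℤ

  χ-geomElt : ∀ L N M .{{_ : NonZero M}} d r → N ℕ.* M ≤ L → r < M →
    χ L M (geomElt d (N ℕ.* M)) r ≡ geomElt d M r * geomSum (d ^ M) N
  χ-geomElt L N M@(suc _) d r NM≤L r<M = begin
    sumTo L (λ k → if k % M ≡ᵇ r then geomElt d NM k else 0ℤ)
      ≡⟨ sumTo-prefix NM L NM≤L beyondSupport ⟩
    sumTo NM (λ k → if k % M ≡ᵇ r then geomElt d NM k else 0ℤ)
      ≡⟨ sumTo-residueClass N M r (geomElt d NM) r<M ⟩
    sumTo N (λ t → geomElt d NM (t ℕ.* M ℕ.+ r))
      ≡⟨ sumTo-cong N (λ t t<N → blockTerm t<N) ⟩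
    sumTo N (λ t → d ^ (M ℕ.∸ 1 ℕ.∸ r) * (d ^ M) ^ (N ℕ.∸ 1 ℕ.∸ t))
      ≡⟨ sumTo-*ˡ N (λ t → (d ^ M) ^ (N ℕ.∸ 1 ℕ.∸ t)) (d ^ (M ℕ.∸ 1 ℕ.∸ r)) ⟩
    d ^ (M ℕ.∸ 1 ℕ.∸ r) * sumTo N (λ t → (d ^ M) ^ (N ℕ.∸ 1 ℕ.∸ t))
      ≡⟨ cong₂ _*_ (if-true (ℕP.<⇒<ᵇ r<M)) (sym (sumTo-reverse N ((d ^ M) ^_))) ⟨
    geomElt d M r * geomSum (d ^ M) N
      ∎
    where
    NM = N ℕ.* M
    beyondSupport : ∀ k → NM ≤ k → (if k % M ≡ᵇ r then geomElt d NM k else 0ℤ) ≡ 0ℤ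
    beyondSupport k NM≤k = trans
      (cong (λ x → if k % M ≡ᵇ r then x else 0ℤ) (if-false (λ k<NM → ℕP.<⇒≱ (ℕP.<ᵇ⇒< k NM k<NM) NM≤k)))
      (if-eta (k % M ≡ᵇ r))
    blockTerm : ∀ {t} → t < N → geomElt d NM (t ℕ.* M ℕ.+ r) ≡ d ^ (M ℕ.∸ 1 ℕ.∸ r) * (d ^ M) ^ (N ℕ.∸ 1 ℕ.∸ t)
    blockTerm {t} t<N = begin
      geomElt d NM (t ℕ.* M ℕ.+ r)                           ≡⟨ if-true (ℕP.<⇒<ᵇ (blockIndex< t<N r<M)) ⟩
      d ^ (NM ℕ.∸ 1 ℕ.∸ (t ℕ.* M ℕ.+ r))                     ≡⟨ cong (d ^_) (blockExponent t<N r<M) ⟩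
      d ^ ((M ℕ.∸ 1 ℕ.∸ r) ℕ.+ (N ℕ.∸ 1 ℕ.∸ t) ℕ.* M)        ≡⟨ ℤP.^-distribˡ-+-* d (M ℕ.∸ 1 ℕ.∸ r) _ ⟩
      d ^ (M ℕ.∸ 1 ℕ.∸ r) * d ^ ((N ℕ.∸ 1 ℕ.∸ t) ℕ.* M)     ≡⟨ cong (λ n → d ^ (M ℕ.∸ 1 ℕ.∸ r) * d ^ n) (ℕP.*-comm (N ℕ.∸ 1 ℕ.∸ t) M) ⟩
      d ^ (M ℕ.∸ 1 ℕ.∸ r) * d ^ (M ℕ.* (N ℕ.∸ 1 ℕ.∸ t))     ≡⟨ cong (d ^ (M ℕ.∸ 1 ℕ.∸ r) *_) (ℤP.^-*-assoc d M (N ℕ.∸ 1 ℕ.∸ t)) ⟨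
      d ^ (M ℕ.∸ 1 ℕ.∸ r) * (d ^ M) ^ (N ℕ.∸ 1 ℕ.∸ t)       ∎

  χ-Q0 : ∀ p .{{_ : NonZero p}} n i j d r → j ≤ i → i ≤ n → r < p ℕ.^ j →
    χ (p ℕ.^ n) (p ℕ.^ j) (Q0 p d i) r ≡ Q0 p d j r * geomSum (d ^ (p ℕ.^ j)) (p ℕ.^ (i ℕ.∸ j))
  χ-Q0 p n i j d r j≤i i≤n r<p^j = begin
    χ (p ℕ.^ n) (p ℕ.^ j) (geomElt d (p ℕ.^ i)) r
      ≡⟨ cong (λ L → χ (p ℕ.^ n) (p ℕ.^ j) (geomElt d L) r) p^i≡p^[i-j]*p^j ⟩
    χ (p ℕ.^ n) (p ℕ.^ j) (geomElt d (p ℕ.^ (i ℕ.∸ j) ℕ.* p ℕ.^ j)) r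
      ≡⟨ χ-geomElt (p ℕ.^ n) (p ℕ.^ (i ℕ.∸ j)) (p ℕ.^ j) {{ℕP.m^n≢0 p j}} d r
           (subst (ℕ._≤ p ℕ.^ n) p^i≡p^[i-j]*p^j (ℕP.^-monoʳ-≤ p i≤n)) r<p^j ⟩
    geomElt d (p ℕ.^ j) r * geomSum (d ^ (p ℕ.^ j)) (p ℕ.^ (i ℕ.∸ j))
      ∎
    where
    p^i≡p^[i-j]*p^j : p ℕ.^ i ≡ p ℕ.^ (i ℕ.∸ j) ℕ.* p ℕ.^ j
    p^i≡p^[i-j]*p^j = trans (cong (p ℕ.^_) (sym (ℕP.m∸n+n≡m j≤i))) (ℕP.^-distribˡ-+-* p (i ℕ.∸ j) j)

  geomSum-* : ∀ e N M → geomSum e (N ℕ.* M) ≡ geomSum (e ^ M) N * geomSum e M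
  geomSum-* e N M = begin
    geomSum e (N ℕ.* M)
      ≡⟨ sumTo-blocks N M (e ^_) ⟩
    sumTo N (λ t → sumTo M (λ s → e ^ (t ℕ.* M ℕ.+ s)))
      ≡⟨ sumTo-cong N (λ t _ → trans (sumTo-cong M (λ s _ → split t s)) (sumTo-*ˡ M (e ^_) ((e ^ M) ^ t))) ⟩
    sumTo N (λ t → (e ^ M) ^ t * geomSum e M)
      ≡⟨ sumTo-*ʳ N ((e ^ M) ^_) (geomSum e M) ⟩
    geomSum (e ^ M) N * geomSum e M
      ∎
    where
    split : ∀ t s → e ^ (t ℕ.* M ℕ.+ s) ≡ (e ^ M) ^ t * e ^ s
    split t s = trans (ℤP.^-distribˡ-+-* e (t ℕ.* M) s)
      (cong (_* e ^ s) (trans (cong (e ^_) (ℕP.*-comm t M)) (sym (ℤP.^-*-assoc e M t))))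

  geomSum-2 : ∀ e → geomSum e 2 ≡ 1ℤ + e
  geomSum-2 e = lemma e
    where
    lemma : ∀ e → 0ℤ + 1ℤ + e * 1ℤ ≡ 1ℤ + e
    lemma = solve-∀

  geomSum-telescope : ∀ e s → (e - 1ℤ) * geomSum e s ≡ e ^ s - 1ℤ
  geomSum-telescope e zero    = ℤP.*-zeroʳ (e - 1ℤ)
  geomSum-telescope e (suc s) = begin
    (e - 1ℤ) * (geomSum e s + e ^ s)            ≡⟨ ℤP.*-distribˡ-+ (e - 1ℤ) (geomSum e s) (e ^ s) ⟩
    (e - 1ℤ) * geomSum e s + (e - 1ℤ) * e ^ s   ≡⟨ cong (_+ (e - 1ℤ) * e ^ s) (geomSum-telescope e s) ⟩
    (e ^ s - 1ℤ) + (e - 1ℤ) * e ^ s             ≡⟨ telescope e (e ^ s) ⟩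
    e * e ^ s - 1ℤ                              ∎
    where
    telescope : ∀ e x → (x - 1ℤ) + (e - 1ℤ) * x ≡ e * x - 1ℤ
    telescope = solve-∀

  ∣x-1⇒∣x^n-1 : ∀ {q} x n → q ∣ x - 1ℤ → q ∣ x ^ n - 1ℤ
  ∣x-1⇒∣x^n-1 {q} x n q∣x-1 = subst (q ∣_) (geomSum-telescope x n) (∣m⇒∣m*n (geomSum x n) q∣x-1)

  ∣x-1⇒∣geomSum-n : ∀ {q} x n → q ∣ x - 1ℤ → q ∣ geomSum x n - + n
  ∣x-1⇒∣geomSum-n {q} x zero    _     = ∣0 q
  ∣x-1⇒∣geomSum-n {q} x (suc n) q∣x-1 = subst (q ∣_) (regroup (geomSum x n) (x ^ n) (+ n))
    (∣m∣n⇒∣m+n (∣x-1⇒∣geomSum-n x n q∣x-1) (∣x-1⇒∣x^n-1 x n q∣x-1))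
    where
    regroup : ∀ g y n → (g - n) + (y - 1ℤ) ≡ (g + y) - (1ℤ + n)
    regroup = solve-∀

  p^k∣geomSum : ∀ p e → + p ∣ e - 1ℤ → ∀ k → + (p ℕ.^ k) ∣ geomSum e (p ℕ.^ k)
  p^k∣geomSum p e _     zero    = divides 1ℤ refl
  p^k∣geomSum p e p∣e-1 (suc k) =
    subst₂ _∣_ (sym (ℤP.pos-* p (p ℕ.^ k))) (sym (geomSum-* e p (p ℕ.^ k)))
      (*-pres-∣ (∣m-n∣n⇒∣m {m = geomSum (e ^ (p ℕ.^ k)) p} (∣x-1⇒∣geomSum-n (e ^ (p ℕ.^ k)) p (∣x-1⇒∣x^n-1 e (p ℕ.^ k) p∣e-1)) ∣-refl)
                (p^k∣geomSum p e p∣e-1 k))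

  geomSum-p^k≡p^k : ∀ p {q} → (∀ x → q ∣ x - 1ℤ → + p * + p ∣ geomSum x p - + p) → ∀ e → q ∣ e - 1ℤ →
    ∀ k → + (p ℕ.^ k) * + p ∣ geomSum e (p ℕ.^ k) - + (p ℕ.^ k)
  geomSum-p^k≡p^k p _ _ _ zero = ∣0 _
  geomSum-p^k≡p^k p base e q∣e-1 (suc k)
    with base (e ^ (p ℕ.^ k)) (∣x-1⇒∣x^n-1 e (p ℕ.^ k) q∣e-1) | geomSum-p^k≡p^k p base e q∣e-1 k
  ... | divides w₁ eq₁ | divides w₂ eq₂ = divides (w₁ + w₂ + w₁ * w₂ * + p) (begin
    geomSum e (p ℕ.* P) - + (p ℕ.* P)
      ≡⟨ cong₂ _-_ (geomSum-* e p P) (ℤP.pos-* p P) ⟩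
    geomSum (e ^ P) p * geomSum e P - + p * + P
      ≡⟨ cong₂ (λ x y → x * y - + p * + P) (x-y≡z⇒x≡z+y (geomSum (e ^ P) p) (+ p) eq₁) (x-y≡z⇒x≡z+y (geomSum e P) (+ P) eq₂) ⟩
    (w₁ * (+ p * + p) + (+ p)) * (w₂ * (+ P * + p) + (+ P)) - + p * + P
      ≡⟨ expand w₁ w₂ (+ p) (+ P) ⟩
    (w₁ + w₂ + w₁ * w₂ * + p) * ((+ p * + P) * + p)
      ≡⟨ cong (λ x → (w₁ + w₂ + w₁ * w₂ * + p) * (x * + p)) (ℤP.pos-* p P) ⟨
    (w₁ + w₂ + w₁ * w₂ * + p) * (+ (p ℕ.* P) * + p)
      ∎)
    where
    P = p ℕ.^ k
    expand : ∀ w₁ w₂ p P → (w₁ * (p * p) + p) * (w₂ * (P * p) + P) - p * P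
                         ≡ (w₁ + w₂ + w₁ * w₂ * p) * ((p * P) * p)
    expand = solve-∀

  geomSumSum : ℤ → ℕ → ℤ
  geomSumSum e s = sumTo s (geomSum e)

  triangular : ℕ → ℤ
  triangular s = sumTo s (λ t → + t)

  geomSum-n≡[x-1]*geomSumSum : ∀ x n → geomSum x n - + n ≡ (x - 1ℤ) * geomSumSum x n
  geomSum-n≡[x-1]*geomSumSum x zero    = sym (ℤP.*-zeroʳ (x - 1ℤ))
  geomSum-n≡[x-1]*geomSumSum x (suc n) = begin
    (geomSum x n + x ^ n) - (1ℤ + + n)                     ≡⟨ regroup (geomSum x n) (x ^ n) (+ n) ⟩
    (geomSum x n - + n) + (x ^ n - 1ℤ)                     ≡⟨ cong₂ _+_ (geomSum-n≡[x-1]*geomSumSum x n) (sym (geomSum-telescope x n)) ⟩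
    (x - 1ℤ) * geomSumSum x n + (x - 1ℤ) * geomSum x n     ≡⟨ ℤP.*-distribˡ-+ (x - 1ℤ) (geomSumSum x n) (geomSum x n) ⟨
    (x - 1ℤ) * (geomSumSum x n + geomSum x n)              ∎
    where
    regroup : ∀ g y n → (g + y) - (1ℤ + n) ≡ (g - n) + (y - 1ℤ)
    regroup = solve-∀

  ∣x-1⇒∣geomSumSum-triangular : ∀ {q} x n → q ∣ x - 1ℤ → q ∣ geomSumSum x n - triangular n
  ∣x-1⇒∣geomSumSum-triangular {q} x zero    _     = ∣0 q
  ∣x-1⇒∣geomSumSum-triangular {q} x (suc n) q∣x-1 =
    subst (q ∣_) (regroup (geomSumSum x n) (geomSum x n) (triangular n) (+ n))
      (∣m∣n⇒∣m+n (∣x-1⇒∣geomSumSum-triangular x n q∣x-1) (∣x-1⇒∣geomSum-n x n q∣x-1))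
    where
    regroup : ∀ h g t n → (h - t) + (g - n) ≡ (h + g) - (t + n)
    regroup = solve-∀

  triangular-Gauss : ∀ n → + 2 * triangular n ≡ + n * (+ n - 1ℤ)
  triangular-Gauss zero    = refl
  triangular-Gauss (suc n) = begin
    + 2 * (triangular n + + n)          ≡⟨ ℤP.*-distribˡ-+ (+ 2) (triangular n) (+ n) ⟩
    + 2 * triangular n + + 2 * + n      ≡⟨ cong (_+ + 2 * + n) (triangular-Gauss n) ⟩
    + n * (+ n - 1ℤ) + + 2 * + n        ≡⟨ step (+ n) ⟩
    (1ℤ + + n) * ((1ℤ + + n) - 1ℤ)      ∎
    where
    step : ∀ n → n * (n - 1ℤ) + + 2 * n ≡ (1ℤ + n) * ((1ℤ + n) - 1ℤ)
    step = solve-∀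

  triangular-odd : ∀ h → triangular (suc (h ℕ.* 2)) ≡ + h * + suc (h ℕ.* 2)
  triangular-odd h = ℤP.*-cancelˡ-≡ (+ 2) _ _ (begin
    + 2 * triangular (suc (h ℕ.* 2))                 ≡⟨ triangular-Gauss (suc (h ℕ.* 2)) ⟩
    (1ℤ + + (h ℕ.* 2)) * ((1ℤ + + (h ℕ.* 2)) - 1ℤ)  ≡⟨ cong (λ x → (1ℤ + x) * ((1ℤ + x) - 1ℤ)) (ℤP.pos-* h 2) ⟩
    (1ℤ + + h * + 2) * ((1ℤ + + h * + 2) - 1ℤ)      ≡⟨ halve (+ h) ⟩
    + 2 * (+ h * (1ℤ + + h * + 2))                   ≡⟨ cong (λ x → + 2 * (+ h * (1ℤ + x))) (ℤP.pos-* h 2) ⟨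
    + 2 * (+ h * (1ℤ + + (h ℕ.* 2)))                 ∎)
    where
    halve : ∀ h → (1ℤ + h * + 2) * ((1ℤ + h * + 2) - 1ℤ) ≡ + 2 * (h * (1ℤ + h * + 2))
    halve = solve-∀

  odd-geomSum≡length : ∀ h x → + suc (h ℕ.* 2) ∣ x - 1ℤ →
    + suc (h ℕ.* 2) * + suc (h ℕ.* 2) ∣ geomSum x (suc (h ℕ.* 2)) - + suc (h ℕ.* 2)
  odd-geomSum≡length h x s∣x-1 = subst (_ ∣_) (sym (geomSum-n≡[x-1]*geomSumSum x (suc (h ℕ.* 2))))
    (*-pres-∣ s∣x-1 (∣m-n∣n⇒∣m {m = geomSumSum x (suc (h ℕ.* 2))} (∣x-1⇒∣geomSumSum-triangular x (suc (h ℕ.* 2)) s∣x-1) (divides (+ h) (triangular-odd h))))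

  geomSum-2≡2 : ∀ x → + 4 ∣ x - 1ℤ → + 2 * + 2 ∣ geomSum x 2 - + 2
  geomSum-2≡2 x 4∣x-1 = subst (+ 4 ∣_) (trans (lemma x) (cong (_- + 2) (sym (geomSum-2 x)))) 4∣x-1
    where
    lemma : ∀ x → x - 1ℤ ≡ (1ℤ + x) - + 2
    lemma = solve-∀

  prime⇒≡2⊎>2 : ∀ {p} → Prime p → p ≡ 2 ⊎ 2 < p
  prime⇒≡2⊎>2 {p} pr with ℕP.m≤n⇒m<n∨m≡n (ℕ.nonTrivial⇒n>1 p {{prime⇒nonTrivial pr}})
  ... | inj₁ 2<p = inj₂ 2<p
  ... | inj₂ 2≡p = inj₁ (sym 2≡p)

  odd-prime : ∀ {p} → Prime p → 2 < p → ∃ λ h → p ≡ suc (h ℕ.* 2)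
  odd-prime {p} pr 2<p with p % 2 | m≡m%n+[m/n]*n p 2 | m%n<n p 2
  ... | 0           | p≡[p/2]*2   | _ with prime⇒irreducible pr (ℕD.divides (p / 2) p≡[p/2]*2)
  ...   | inj₁ ()
  ...   | inj₂ 2≡p = ⊥-elim (ℕP.<-irrefl 2≡p 2<p)
  odd-prime {p} pr 2<p | 1 | p≡1+[p/2]*2 | _ = p / 2 , p≡1+[p/2]*2
  odd-prime {p} pr 2<p | suc (suc _) | _ | s≤s (s≤s ())

  ∈U₁⇒∣ : ∀ {p} d → d ∈U[ p , 1 ] → + p ∣ d - 1ℤ
  ∈U₁⇒∣ {p} d d∈U₁ = subst (λ n → + n ∣ d - 1ℤ) (ℕP.*-identityʳ p) (∣ᵤ⇒∣ d∈U₁)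

  odd²≡1 : ∀ d → + 2 ∣ d - 1ℤ → + 4 ∣ d ^ 2 - 1ℤ
  odd²≡1 d (divides a d-1≡2a) =
    divides (a * a + a) (trans (cong (λ x → x ^ 2 - 1ℤ) (x-y≡z⇒x≡z+y d 1ℤ d-1≡2a)) (square a))
    where
    square : ∀ a → (a * + 2 + 1ℤ) * ((a * + 2 + 1ℤ) * 1ℤ) - 1ℤ ≡ (a * a + a) * + 4
    square = solve-∀

  4∣d^2^j-1 : ∀ d j → d ∈U[ 2 , 1 ] → d ∈U[ 2 , 2 ] ⊎ 0 < j → + 4 ∣ d ^ (2 ℕ.^ j) - 1ℤ
  4∣d^2^j-1 d j       _     (inj₁ d∈U₂) = ∣x-1⇒∣x^n-1 d (2 ℕ.^ j) (∣ᵤ⇒∣ d∈U₂)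
  4∣d^2^j-1 d (suc j) d∈U₁ (inj₂ _)    = subst (λ x → + 4 ∣ x - 1ℤ) (ℤP.^-*-assoc d 2 (2 ℕ.^ j))
    (∣x-1⇒∣x^n-1 (d ^ 2) (2 ℕ.^ j) (odd²≡1 d (∈U₁⇒∣ d d∈U₁)))

  geomSum-≡p^k : ∀ p d j → Prime p → d ∈U[ p , 1 ] → (2 < p ⊎ d ∈U[ p , 2 ] ⊎ 0 < j) →
    ∀ k → + (p ℕ.^ (k ℕ.+ 1)) ∣ geomSum (d ^ (p ℕ.^ j)) (p ℕ.^ k) - + (p ℕ.^ k)
  geomSum-≡p^k p d j pr d∈U₁ cond k = subst (_∣ geomSum (d ^ (p ℕ.^ j)) (p ℕ.^ k) - + (p ℕ.^ k)) (sym p^[k+1]≡p^k*p) (≡p^k (prime⇒≡2⊎>2 pr) cond)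
    where
    p^[k+1]≡p^k*p : + (p ℕ.^ (k ℕ.+ 1)) ≡ + (p ℕ.^ k) * + p
    p^[k+1]≡p^k*p = trans (cong +_ (trans (ℕP.^-distribˡ-+-* p k 1) (cong (p ℕ.^ k ℕ.*_) (ℕP.*-identityʳ p))))
                          (ℤP.pos-* (p ℕ.^ k) p)
    ≡p^k : p ≡ 2 ⊎ 2 < p → (2 < p ⊎ d ∈U[ p , 2 ] ⊎ 0 < j) →
      + (p ℕ.^ k) * + p ∣ geomSum (d ^ (p ℕ.^ j)) (p ℕ.^ k) - + (p ℕ.^ k)
    ≡p^k (inj₂ 2<p) _ with odd-prime pr 2<p
    ... | h , refl = geomSum-p^k≡p^k p (odd-geomSum≡length h) (d ^ (p ℕ.^ j))
                       (∣x-1⇒∣x^n-1 d (p ℕ.^ j) (∈U₁⇒∣ d d∈U₁)) k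
    ≡p^k (inj₁ refl) (inj₁ (s≤s (s≤s ())))
    ≡p^k (inj₁ refl) (inj₂ U₂⊎0<j) =
      geomSum-p^k≡p^k 2 geomSum-2≡2 (d ^ (2 ℕ.^ j)) (4∣d^2^j-1 d j d∈U₁ U₂⊎0<j) k

  geomSum[-1]-2^[1+i] : ∀ i → geomSum (- 1ℤ) (2 ℕ.^ suc i) ≡ 0ℤ
  geomSum[-1]-2^[1+i] i = begin
    geomSum (- 1ℤ) (2 ℕ.* 2 ℕ.^ i)                    ≡⟨ cong (geomSum (- 1ℤ)) (ℕP.*-comm 2 (2 ℕ.^ i)) ⟩
    geomSum (- 1ℤ) (2 ℕ.^ i ℕ.* 2)                    ≡⟨ geomSum-* (- 1ℤ) (2 ℕ.^ i) 2 ⟩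
    geomSum ((- 1ℤ) ^ 2) (2 ℕ.^ i) * geomSum (- 1ℤ) 2 ≡⟨ ℤP.*-zeroʳ (geomSum ((- 1ℤ) ^ 2) (2 ℕ.^ i)) ⟩
    0ℤ                                                 ∎

  odd-2-part : ∀ {x} v → + (2 ℕ.^ v) Unsigned.∣ x → ¬ (+ (2 ℕ.^ (v ℕ.+ 1)) Unsigned.∣ x) →
    ∃ λ c → x ≡ (1ℤ + c * + 2) * + (2 ℕ.^ v)
  odd-2-part {x} v 2^v∣x 2^[v+1]∤x with ∣ᵤ⇒∣ 2^v∣x
  ... | divides b x≡b*2^v with b ℤD.%ℕ 2 | ℤD.a≡a%ℕn+[a/ℕn]*n b 2 | ℤD.n%ℕd<d b 2
  ...   | 0 | b≡[b/2]*2 | _ = ⊥-elim (2^[v+1]∤x (∣⇒∣ᵤ (divides (b ℤD./ℕ 2) (begin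
    x                                              ≡⟨ x≡b*2^v ⟩
    b * + (2 ℕ.^ v)                                ≡⟨ cong (_* + (2 ℕ.^ v)) b≡[b/2]*2 ⟩
    (0ℤ + b ℤD./ℕ 2 * + 2) * + (2 ℕ.^ v)           ≡⟨ regroup (b ℤD./ℕ 2) (+ (2 ℕ.^ v)) ⟩
    b ℤD./ℕ 2 * (+ (2 ℕ.^ v) * + 2)                ≡⟨ cong (b ℤD./ℕ 2 *_) (ℤP.pos-* (2 ℕ.^ v) 2) ⟨
    b ℤD./ℕ 2 * + (2 ℕ.^ v ℕ.* 2)                  ≡⟨ cong (λ n → b ℤD./ℕ 2 * + n) (ℕP.^-distribˡ-+-* 2 v 1) ⟨
    b ℤD./ℕ 2 * + (2 ℕ.^ (v ℕ.+ 1))                ∎))))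
    where
    regroup : ∀ c V → (0ℤ + c * + 2) * V ≡ c * (V * + 2)
    regroup = solve-∀
  ...   | 1           | b≡1+[b/2]*2 | _ = b ℤD./ℕ 2 , trans x≡b*2^v (cong (_* + (2 ℕ.^ v)) b≡1+[b/2]*2)
  ...   | suc (suc _) | _           | s≤s (s≤s ())

  geomSum-negOdd : ∀ d c v i → + 2 ∣ d - 1ℤ → - d - 1ℤ ≡ (1ℤ + c * + 2) * + (2 ℕ.^ v) →
    + (2 ℕ.^ suc (i ℕ.+ v)) ∣ geomSum d (2 ℕ.^ suc i) - + (2 ℕ.^ (i ℕ.+ v))
  geomSum-negOdd d c v i 2∣d-1 -d-1≡odd*2^v
    with geomSum-p^k≡p^k 2 geomSum-2≡2 (d ^ 2) (odd²≡1 d 2∣d-1) i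
  ... | divides w eq = divides (- (1ℤ + c + w + + 2 * w * c)) (begin
    geomSum d (2 ℕ.* 2 ℕ.^ i) - + (2 ℕ.^ (i ℕ.+ v))
      ≡⟨ cong₂ _-_ (trans (cong (geomSum d) (ℕP.*-comm 2 (2 ℕ.^ i))) (geomSum-* d (2 ℕ.^ i) 2)) 2^[i+v] ⟩
    geomSum (d ^ 2) (2 ℕ.^ i) * geomSum d 2 - A * V
      ≡⟨ cong₂ (λ x y → x * y - A * V) (x-y≡z⇒x≡z+y (geomSum (d ^ 2) (2 ℕ.^ i)) A eq) 1+d≡-odd*2^v ⟩
    (w * (A * + 2) + A) * - ((1ℤ + c * + 2) * V) - A * V
      ≡⟨ expand w c A V ⟩
    - (1ℤ + c + w + + 2 * w * c) * (+ 2 * (A * V))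
      ≡⟨ cong (λ x → - (1ℤ + c + w + + 2 * w * c) * x) 2^[1+i+v] ⟨
    - (1ℤ + c + w + + 2 * w * c) * + (2 ℕ.^ suc (i ℕ.+ v))
      ∎)
    where
    A = + (2 ℕ.^ i)
    V = + (2 ℕ.^ v)
    2^[i+v] : + (2 ℕ.^ (i ℕ.+ v)) ≡ A * V
    2^[i+v] = trans (cong +_ (ℕP.^-distribˡ-+-* 2 i v)) (ℤP.pos-* (2 ℕ.^ i) (2 ℕ.^ v))
    2^[1+i+v] : + (2 ℕ.^ suc (i ℕ.+ v)) ≡ + 2 * (A * V)
    2^[1+i+v] = trans (ℤP.pos-* 2 (2 ℕ.^ (i ℕ.+ v))) (cong (+ 2 *_) 2^[i+v])
    1+d≡-odd*2^v : geomSum d 2 ≡ - ((1ℤ + c * + 2) * V)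
    1+d≡-odd*2^v = trans (geomSum-2 d) (trans (negate d) (cong -_ -d-1≡odd*2^v))
      where
      negate : ∀ d → 1ℤ + d ≡ - (- d - 1ℤ)
      negate = solve-∀
    expand : ∀ w c A V → (w * (A * + 2) + A) * - ((1ℤ + c * + 2) * V) - A * V
                       ≡ - (1ℤ + c + w + + 2 * w * c) * (+ 2 * (A * V))
    expand = solve-∀

  inMul-factor : ∀ {pm N s S} {a : GR} (b : GR) → (∀ r → r < N → a r ≡ b r * S) → s ∣ S → InMul pm N s a
  inMul-factor {pm} {s = s} {a = a} b a≡bS (divides c S≡cs) = (λ r → b r * c) , λ r r<N →
    subst (Unsigned._∣_ (+ pm)) (sym (vanish r r<N)) (pm ℕD.∣0)
    where
    cancel : ∀ b c s → b * (c * s) - s * (b * c) ≡ 0ℤ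
    cancel = solve-∀
    vanish : ∀ r → r < _ → a r - s * (b r * c) ≡ 0ℤ
    vanish r r<N = trans (cong (λ x → x - s * (b r * c)) (trans (a≡bS r r<N) (cong (b r *_) S≡cs))) (cancel (b r) c s)

  congMod-factor : ∀ {pm N s S} {a : GR} c (b : GR) → (∀ r → r < N → a r ≡ b r * S) → s ∣ S - c →
    CongMod pm N s a (c · b)
  congMod-factor {S = S} {a} c b a≡bS =
    inMul-factor b (λ r r<N → trans (cong (_- c * b r) (a≡bS r r<N)) (factor (b r) S c))
    where
    factor : ∀ b S c → b * S - c * b ≡ b * (S - c)
    factor = solve-∀

  χ-Q0-divisible : ∀ p .{{_ : NonZero p}} n m i j d → j ≤ i → i ≤ n → d ∈U[ p , 1 ] →
    InMul (p ℕ.^ m) (p ℕ.^ j) (+ (p ℕ.^ (i ℕ.∸ j))) (χ (p ℕ.^ n) (p ℕ.^ j) (Q0 p d i))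
  χ-Q0-divisible p n m i j d j≤i i≤n d∈U₁ =
    inMul-factor (Q0 p d j) (λ r → χ-Q0 p n i j d r j≤i i≤n)
      (p^k∣geomSum p (d ^ (p ℕ.^ j)) (∣x-1⇒∣x^n-1 d (p ℕ.^ j) (∈U₁⇒∣ d d∈U₁)) (i ℕ.∸ j))

  χ-Q0-congruence : ∀ p n m i j d → Prime p → j ≤ i → i ≤ n → d ∈U[ p , 1 ] → (2 < p ⊎ d ∈U[ p , 2 ] ⊎ 0 < j) →
    CongMod (p ℕ.^ m) (p ℕ.^ j) (+ (p ℕ.^ (i ℕ.∸ j ℕ.+ 1)))
      (χ (p ℕ.^ n) (p ℕ.^ j) (Q0 p d i)) ((+ (p ℕ.^ (i ℕ.∸ j))) · Q0 p d j)
  χ-Q0-congruence p n m i j d pr j≤i i≤n d∈U₁ cond =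
    congMod-factor (+ (p ℕ.^ (i ℕ.∸ j))) (Q0 p d j) (λ r → χ-Q0 p {{prime⇒nonZero pr}} n i j d r j≤i i≤n)
      (geomSum-≡p^k p d j pr d∈U₁ cond (i ℕ.∸ j))

  χ-Q0-vanishes : ∀ n m i → 0 < i → i ≤ n → IsZero (2 ℕ.^ m) 1 (χ (2 ℕ.^ n) 1 (Q0 2 (- 1ℤ) i))
  χ-Q0-vanishes n m (suc i) _ i≤n zero _ = subst (Unsigned._∣_ (+ (2 ℕ.^ m))) (sym (begin
    χ (2 ℕ.^ n) 1 (Q0 2 (- 1ℤ) (suc i)) 0     ≡⟨ χ-Q0 2 n (suc i) 0 (- 1ℤ) 0 z≤n i≤n (s≤s z≤n) ⟩
    1ℤ * geomSum (- 1ℤ) (2 ℕ.^ suc i)         ≡⟨ ℤP.*-identityˡ _ ⟩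
    geomSum (- 1ℤ) (2 ℕ.^ suc i)              ≡⟨ geomSum[-1]-2^[1+i] i ⟩
    0ℤ                                         ∎)) ((2 ℕ.^ m) ℕD.∣0)
  χ-Q0-vanishes n m (suc i) _ i≤n (suc r) (s≤s ())

  χ-Q0-2adic : ∀ n m i v d → 0 < i → i ≤ n → d ∈U[ 2 , 1 ] → (- d) ∈U[ 2 , v ] → ¬ ((- d) ∈U[ 2 , v ℕ.+ 1 ]) →
    CongMod (2 ℕ.^ m) 1 (+ (2 ℕ.^ (i ℕ.+ v))) (χ (2 ℕ.^ n) 1 (Q0 2 d i)) (scalar (+ (2 ℕ.^ (i ℕ.+ v ℕ.∸ 1))))
  χ-Q0-2adic n m (suc i) v d _ i≤n d∈U₁ -d∈Uᵥ -d∉Uᵥ₊₁ with odd-2-part v -d∈Uᵥ -d∉Uᵥ₊₁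
  ... | c , -d-1≡odd*2^v = inMul-factor (λ _ → 1ℤ) value (geomSum-negOdd d c v i (∈U₁⇒∣ d d∈U₁) -d-1≡odd*2^v)
    where
    value : ∀ r → r < 1 → χ (2 ℕ.^ n) 1 (Q0 2 d (suc i)) r - scalar (+ (2 ℕ.^ (i ℕ.+ v))) r
                        ≡ 1ℤ * (geomSum d (2 ℕ.^ suc i) - + (2 ℕ.^ (i ℕ.+ v)))
    value zero _ = begin
      χ (2 ℕ.^ n) 1 (Q0 2 d (suc i)) 0 - X      ≡⟨ cong (_- X) (χ-Q0 2 n (suc i) 0 d 0 z≤n i≤n (s≤s z≤n)) ⟩
      1ℤ * geomSum (d ^ 1) (2 ℕ.^ suc i) - X    ≡⟨ cong (λ x → 1ℤ * geomSum x (2 ℕ.^ suc i) - X) (ℤP.^-identityʳ d) ⟩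
      1ℤ * geomSum d (2 ℕ.^ suc i) - X          ≡⟨ unit (geomSum d (2 ℕ.^ suc i)) X ⟩
      1ℤ * (geomSum d (2 ℕ.^ suc i) - X)        ∎
      where
      X = + (2 ℕ.^ (i ℕ.+ v))
      unit : ∀ g x → 1ℤ * g - x ≡ 1ℤ * (g - x)
      unit = solve-∀
    value (suc r) (s≤s ())

open import Data.Nat.Base using (_^_; _+_; _∸_)

lemma2p7 : (p n m i j : ℕ) → Prime p → j < i → i ≤ n → (d : ℤ) → d ∈U[ p , 1 ] →
    InMul (p ^ m) (p ^ j) (+ (p ^ (i ∸ j))) (χ (p ^ n) (p ^ j) (Q0 p d i))
    × ((2 < p ⊎ d ∈U[ p , 2 ] ⊎ 0 < j) →
         CongMod (p ^ m) (p ^ j) (+ (p ^ (i ∸ j + 1)))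
           (χ (p ^ n) (p ^ j) (Q0 p d i)) ((+ (p ^ (i ∸ j))) · Q0 p d j))
    × (p ≡ 2 → d ≡ - (+ 1) → j ≡ 0 →
         IsZero (p ^ m) (p ^ j) (χ (p ^ n) (p ^ j) (Q0 p d i)))
    × (p ≡ 2 → (v : ℕ) → 2 ≤ v → (- d) ∈U[ p , v ] → ¬ ((- d) ∈U[ p , v + 1 ]) → j ≡ 0 →
         CongMod (p ^ m) (p ^ j) (+ (2 ^ (i + v))) (χ (p ^ n) (p ^ j) (Q0 p d i))
           (scalar (+ (2 ^ (i + v ∸ 1)))))
lemma2p7 p n m i j pr j<i i≤n d d∈U₁ =
    χ-Q0-divisible p {{prime⇒nonZero pr}} n m i j d (ℕP.<⇒≤ j<i) i≤n d∈U₁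
  , χ-Q0-congruence p n m i j d pr (ℕP.<⇒≤ j<i) i≤n d∈U₁
  , (λ { refl refl refl → χ-Q0-vanishes n m i j<i i≤n })
  , λ { refl v _ -d∈Uᵥ -d∉Uᵥ₊₁ refl → χ-Q0-2adic n m i v d j<i i≤n d∈U₁ -d∈Uᵥ -d∉Uᵥ₊₁ }
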